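{- Let $n\ge1$ and $Q_n=\{(\kappa_1,\kappa_2,\kappa_3,\kappa_4)\in\mathbb{Z}_{\ge0}^4:\kappa_3\le1,\ \kappa_1+\kappa_2+\kappa_3+\kappa_4=n,\ \kappa_4\le\kappa_1+\kappa_2\}$. For $0\le j\le\lfloor 3n/2\rfloor$ let the $j$-strand be $\{\kappa\in Q_n:\kappa_2+\kappa_3+2\kappa_4=j\}$, and let its final point be its point with largest $\kappa_2$. Then every final point has $\kappa_3=0$ and lies either on the line $\kappa_1+\kappa_2=n$ (so $\kappa_4=0$) or on the line $\kappa_2+\kappa_4=n$ with $\kappa_2\ge\kappa_4$ (so $\kappa_1=0$). More precisely, the final point of the $j$-strand is $(\kappa_1,\kappa_2,\kappa_3,\kappa_4)=(n-j,j,0,0)$ if $0\le j\le n$, and $(0,2n-j,0,j-n)$ if $n\le j\le\lfloor 3n/2\rfloor$.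
   Context: The point $\kappa\in Q_n$ corresponds to a semistandard tableau of shape $(3\kappa_1+2\kappa_2+2\kappa_3+\kappa_4,\ \kappa_2+\kappa_3+2\kappa_4)=(3n-j,j)$ and content $(n,n,n)$; the $j$-strand corresponds to all such tableaux of shape $(3n-j,j)$, and within it points are related by the moves $\kappa\mapsto\kappa+(-1,1,1,-1)$ (when $\kappa_3=0$) and $\kappa\mapsto\kappa+(0,1,-1,0)$ (when $\kappa_3=1$), each increasing $\kappa_2$ by one. -}

module Defs where

open import Data.Nat using (ℕ; _+_; _*_; _≤_)
open import Data.Product using (_×_; _,_)
open import Relation.Binary.PropositionalEquality using (_≡_)

record Pt : Set where
  constructor pt
  field
    κ₁ κ₂ κ₃ κ₄ : ℕ
open Pt public

InQ : ℕ → Pt → Set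
InQ n κ = (κ₃ κ ≤ 1) × (κ₁ κ + κ₂ κ + κ₃ κ + κ₄ κ ≡ n) × (κ₄ κ ≤ κ₁ κ + κ₂ κ)

InStrand : ℕ → ℕ → Pt → Set
InStrand n j κ = InQ n κ × (κ₂ κ + κ₃ κ + 2 * κ₄ κ ≡ j)

IsFinal : ℕ → ℕ → Pt → Set
IsFinal n j κ = InStrand n j κ × (∀ κ' → InStrand n j κ' → κ₂ κ' ≤ κ₂ κ)

{-# OPTIONS --safe #-}
module Submission where

-- Along a strand the two defining equations pin down the coordinate κ₂ up to a
-- nonnegative "excess": for j ≤ n one has κ₂ + (κ₃ + 2κ₄) = j, and for j = n + m
-- subtracting the equations gives κ₄ = κ₁ + m, whence κ₂ + (2κ₁ + κ₃) = n − m.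
-- So κ₂ is at most j, resp. n − m, with equality exactly when the excess
-- vanishes, and a vanishing excess leaves a single point of the strand:
-- (n − j, j, 0, 0), resp. (0, n − m, 0, m).  The constraint j ≤ ⌊3n/2⌋ is
-- 2m ≤ n, i.e. κ₄ ≤ κ₁ + κ₂ for the second point.

open import Defs
open import Data.Nat using (ℕ; _+_; _*_; _∸_; _≤_; z≤n; ⌊_/2⌋; ⌈_/2⌉)
open import Data.Nat.Properties
open import Data.Nat.Tactic.RingSolver using (solve-∀)
open import Data.Product using (_×_; _,_)
open import Data.Sum using (_⊎_; inj₁; inj₂)
open import Function.Bundles using (_⇔_; mk⇔; module Equivalence)
open import Relation.Binary.PropositionalEquality

m≤⌊n/2⌋⇒m+m≤n : ∀ {m n} → m ≤ ⌊ n /2⌋ → m + m ≤ n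
m≤⌊n/2⌋⇒m+m≤n {m} {n} m≤⌊n/2⌋ = begin
  m + m               ≤⟨ +-mono-≤ m≤⌊n/2⌋ (≤-trans m≤⌊n/2⌋ (⌊n/2⌋≤⌈n/2⌉ n)) ⟩
  ⌊ n /2⌋ + ⌈ n /2⌉   ≡⟨ ⌊n/2⌋+⌈n/2⌉≡n n ⟩
  n                   ∎
  where
  open ≤-Reasoning

n+m≤⌊3n/2⌋⇒m+m≤n : ∀ n m → n + m ≤ ⌊ 3 * n /2⌋ → m + m ≤ n
n+m≤⌊3n/2⌋⇒m+m≤n n m bound = +-cancelˡ-≤ (n + n) (m + m) n (begin
  n + n + (m + m)       ≡⟨ regroup n m ⟩
  n + m + (n + m)       ≤⟨ m≤⌊n/2⌋⇒m+m≤n bound ⟩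
  3 * n                 ≡⟨ triple n ⟩
  n + n + n             ∎)
  where
  open ≤-Reasoning
  regroup : ∀ n m → n + n + (m + m) ≡ n + m + (n + m)
  regroup = solve-∀
  triple : ∀ n → 3 * n ≡ n + n + n
  triple = solve-∀

2*n∸j≡n∸[j∸n] : ∀ {n j} → n ≤ j → 2 * n ∸ j ≡ n ∸ (j ∸ n)
2*n∸j≡n∸[j∸n] {n} {j} n≤j = begin
  2 * n ∸ j                    ≡⟨ cong₂ _∸_ (cong (n +_) (+-identityʳ n)) (sym (m+[n∸m]≡n n≤j)) ⟩
  n + n ∸ (n + (j ∸ n))        ≡⟨ [m+n]∸[m+o]≡n∸o n n (j ∸ n) ⟩
  n ∸ (j ∸ n)                  ∎
  where open ≡-Reasoning

isFinal⇔≡ : ∀ {n j top} (excess : Pt → ℕ) (p : Pt) →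
  InStrand n j p → κ₂ p ≡ top →
  (∀ κ → InStrand n j κ → κ₂ κ + excess κ ≡ top) →
  (∀ κ → InStrand n j κ → excess κ ≡ 0 → κ ≡ p) →
  ∀ κ → IsFinal n j κ ⇔ (κ ≡ p)
isFinal⇔≡ {n} {j} {top} excess p p∈strand κ₂p≡top κ₂+excess≡top noExcess⇒≡p κ =
  mk⇔ final⇒≡p (λ { refl → p∈strand , κ₂≤κ₂p })
  where
  open ≡-Reasoning

  κ₂≤top : ∀ κ → InStrand n j κ → κ₂ κ ≤ top
  κ₂≤top κ κ∈strand = subst (κ₂ κ ≤_) (κ₂+excess≡top κ κ∈strand) (m≤m+n (κ₂ κ) (excess κ))

  κ₂≤κ₂p : ∀ κ → InStrand n j κ → κ₂ κ ≤ κ₂ p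
  κ₂≤κ₂p κ κ∈strand = subst (κ₂ κ ≤_) (sym κ₂p≡top) (κ₂≤top κ κ∈strand)

  final⇒≡p : IsFinal n j κ → κ ≡ p
  final⇒≡p (κ∈strand , maximal) = noExcess⇒≡p κ κ∈strand (+-cancelˡ-≡ (κ₂ κ) (excess κ) 0 (begin
    κ₂ κ + excess κ   ≡⟨ κ₂+excess≡top κ κ∈strand ⟩
    top               ≡⟨ ≤-antisym (κ₂≤top κ κ∈strand) (subst (_≤ κ₂ κ) κ₂p≡top (maximal p p∈strand)) ⟨
    κ₂ κ              ≡⟨ +-identityʳ (κ₂ κ) ⟨
    κ₂ κ + 0          ∎))

finalPoint-lower : ∀ n j → j ≤ n → ∀ κ → IsFinal n j κ ⇔ (κ ≡ pt (n ∸ j) j 0 0)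
finalPoint-lower n j j≤n =
  isFinal⇔≡ excess (pt (n ∸ j) j 0 0) p∈strand refl κ₂+excess≡j noExcess⇒≡p
  where
  excess : Pt → ℕ
  excess κ = κ₃ κ + 2 * κ₄ κ

  p∈strand : InStrand n j (pt (n ∸ j) j 0 0)
  p∈strand = (z≤n , trans (+-identityʳ _) (trans (+-identityʳ _) (m∸n+n≡m j≤n)) , z≤n)
           , trans (+-identityʳ _) (+-identityʳ j)

  κ₂+excess≡j : ∀ κ → InStrand n j κ → κ₂ κ + excess κ ≡ j
  κ₂+excess≡j κ (_ , onStrand) = trans (sym (+-assoc (κ₂ κ) (κ₃ κ) (2 * κ₄ κ))) onStrand

  noExcess⇒≡p : ∀ κ → InStrand n j κ → excess κ ≡ 0 → κ ≡ pt (n ∸ j) j 0 0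
  noExcess⇒≡p (pt a b c d) ((_ , sum≡n , _) , onStrand) c+2d≡0
    with m+n≡0⇒m≡0 c c+2d≡0 | m+n≡0⇒m≡0 d (m+n≡0⇒n≡0 c c+2d≡0)
  ... | refl | refl with trans (sym (+-identityʳ b)) (trans (sym (+-identityʳ (b + 0))) onStrand)
  ... | refl = cong (λ a → pt a j 0 0) (begin
    a                  ≡⟨ m+n∸n≡m a j ⟨
    a + j ∸ j          ≡⟨ cong (_∸ j) (trans (sym (+-identityʳ (a + j))) (trans (sym (+-identityʳ (a + j + 0))) sum≡n)) ⟩
    n ∸ j              ∎)
    where open ≡-Reasoning

module UpperStrand (n m : ℕ) (m+m≤n : m + m ≤ n) where

  m≤n : m ≤ n
  m≤n = m+n≤o⇒m≤o m m+m≤n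

  κ₄≡κ₁+m : ∀ κ → InStrand n (n + m) κ → κ₄ κ ≡ κ₁ κ + m
  κ₄≡κ₁+m (pt a b c d) ((_ , sum≡n , _) , onStrand) = +-cancelˡ-≡ (b + c + d) d (a + m) (begin
    b + c + d + d           ≡⟨ doubleLast b c d ⟩
    b + c + 2 * d           ≡⟨ onStrand ⟩
    n + m                   ≡⟨ cong (_+ m) sum≡n ⟨
    a + b + c + d + m       ≡⟨ moveFirst a b c d m ⟩
    b + c + d + (a + m)     ∎)
    where
    open ≡-Reasoning
    doubleLast : ∀ b c d → b + c + d + d ≡ b + c + 2 * d
    doubleLast = solve-∀
    moveFirst : ∀ a b c d m → a + b + c + d + m ≡ b + c + d + (a + m)
    moveFirst = solve-∀

  excess : Pt → ℕ
  excess κ = κ₁ κ + κ₁ κ + κ₃ κ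

  κ₂+excess≡n∸m : ∀ κ → InStrand n (n + m) κ → κ₂ κ + excess κ ≡ n ∸ m
  κ₂+excess≡n∸m κ@(pt a b c d) κ∈strand@((_ , sum≡n , _) , _) =
    trans (sym (m+n∸n≡m (b + excess κ) m)) (cong (_∸ m) (begin
      b + (a + a + c) + m     ≡⟨ regroup a b c m ⟩
      a + b + c + (a + m)     ≡⟨ cong (a + b + c +_) (κ₄≡κ₁+m κ κ∈strand) ⟨
      a + b + c + d           ≡⟨ sum≡n ⟩
      n                       ∎))
    where
    open ≡-Reasoning
    regroup : ∀ a b c m → b + (a + a + c) + m ≡ a + b + c + (a + m)
    regroup = solve-∀

  p∈strand : InStrand n (n + m) (pt 0 (n ∸ m) 0 m)
  p∈strand = (z≤n , trans (cong (_+ m) (+-identityʳ (n ∸ m))) (m∸n+n≡m m≤n)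
             , m+n≤o⇒m≤o∸n m m+m≤n)
           , trans (regroup (n ∸ m) m) (cong (_+ m) (m∸n+n≡m m≤n))
    where
    regroup : ∀ x m → x + 0 + 2 * m ≡ x + m + m
    regroup = solve-∀

  noExcess⇒≡p : ∀ κ → InStrand n (n + m) κ → excess κ ≡ 0 → κ ≡ pt 0 (n ∸ m) 0 m
  noExcess⇒≡p κ@(pt a b c d) κ∈strand a+a+c≡0
    with m+n≡0⇒m≡0 a (m+n≡0⇒m≡0 (a + a) a+a+c≡0) | m+n≡0⇒n≡0 (a + a) a+a+c≡0
  ... | refl | refl =
    cong₂ (λ b d → pt 0 b 0 d)
          (trans (sym (+-identityʳ b)) (κ₂+excess≡n∸m κ κ∈strand))
          (κ₄≡κ₁+m κ κ∈strand)

  finalPoint : ∀ κ → IsFinal n (n + m) κ ⇔ (κ ≡ pt 0 (n ∸ m) 0 m)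
  finalPoint = isFinal⇔≡ excess (pt 0 (n ∸ m) 0 m) p∈strand refl κ₂+excess≡n∸m noExcess⇒≡p

finalPoint-upper : ∀ n j → n ≤ j → j ≤ ⌊ 3 * n /2⌋ →
  ∀ κ → IsFinal n j κ ⇔ (κ ≡ pt 0 (2 * n ∸ j) 0 (j ∸ n))
finalPoint-upper n j n≤j j≤⌊3n/2⌋ rewrite 2*n∸j≡n∸[j∸n] n≤j
  with j ∸ n | m+[n∸m]≡n n≤j
... | m | refl = UpperStrand.finalPoint n m (n+m≤⌊3n/2⌋⇒m+m≤n n m j≤⌊3n/2⌋)

OnBoundaryLines : ℕ → Pt → Set
OnBoundaryLines n κ =
  (κ₃ κ ≡ 0) × ((κ₁ κ + κ₂ κ ≡ n × κ₄ κ ≡ 0) ⊎ (κ₂ κ + κ₄ κ ≡ n × κ₄ κ ≤ κ₂ κ × κ₁ κ ≡ 0))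

finalPoint-onBoundaryLines : ∀ n j → j ≤ ⌊ 3 * n /2⌋ → ∀ κ → IsFinal n j κ → OnBoundaryLines n κ
finalPoint-onBoundaryLines n j j≤⌊3n/2⌋ κ final with ≤-total j n
... | inj₁ j≤n with Equivalence.to (finalPoint-lower n j j≤n κ) final
...   | refl = refl , inj₁ (m∸n+n≡m j≤n , refl)
finalPoint-onBoundaryLines n j j≤⌊3n/2⌋ κ final | inj₂ n≤j
  with Equivalence.to (finalPoint-upper n j n≤j j≤⌊3n/2⌋ κ) final
... | refl rewrite 2*n∸j≡n∸[j∸n] n≤j =
  refl , inj₂ (m∸n+n≡m m≤n , m+n≤o⇒m≤o∸n m m+m≤n , refl)
  where
  m = j ∸ n
  m+m≤n : m + m ≤ n
  m+m≤n = n+m≤⌊3n/2⌋⇒m+m≤n n m (subst (_≤ ⌊ 3 * n /2⌋) (sym (m+[n∸m]≡n n≤j)) j≤⌊3n/2⌋)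
  m≤n : m ≤ n
  m≤n = m+n≤o⇒m≤o m m+m≤n

mainTheorem11 : (n : ℕ) → 1 ≤ n → (j : ℕ) → j ≤ ⌊ 3 * n /2⌋ →
    (∀ κ → IsFinal n j κ →
      (κ₃ κ ≡ 0) × ((κ₁ κ + κ₂ κ ≡ n × κ₄ κ ≡ 0) ⊎ (κ₂ κ + κ₄ κ ≡ n × κ₄ κ ≤ κ₂ κ × κ₁ κ ≡ 0)))
    × (j ≤ n → ∀ κ → IsFinal n j κ ⇔ (κ ≡ pt (n ∸ j) j 0 0))
    × (n ≤ j → ∀ κ → IsFinal n j κ ⇔ (κ ≡ pt 0 (2 * n ∸ j) 0 (j ∸ n)))
mainTheorem11 n _ j j≤⌊3n/2⌋ =
    finalPoint-onBoundaryLines n j j≤⌊3n/2⌋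
  , finalPoint-lower n j
  , λ n≤j → finalPoint-upper n j n≤j j≤⌊3n/2⌋
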